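{- Let $n$ be a positive integer. If $n \equiv 1 \pmod 3$, then $$n \leq \operatorname{adim}(P_3 \square P_n) \leq n+1.$$ Otherwise, $$n-1 \leq \operatorname{adim}(P_3 \square P_n) \leq n.$$
   Context: All graphs are finite, simple and undirected. $P_n$ denotes the path graph on $n$ vertices and $G_1 \square G_2$ the Cartesian product: vertex set $V(G_1)\times V(G_2)$, with $(u,u')$ adjacent to $(v,v')$ iff either $u=v$ and $u'v' \in E(G_2)$, or $u'=v'$ and $uv\in E(G_1)$. For vertices $u,v$, $d(u,v)$ is the length of a shortest path between them ($\infty$ if none), and $d_1(u,v) := \min(d(u,v),2)$. A set $A \subseteq V(G)$ is an adjacency resolving set of $G$ if for any distinct $x,y \in V(G)$ there is $z \in A$ with $d_1(z,x) \neq d_1(z,y)$. The adjacency dimension $\operatorname{adim}(G)$ is the minimum cardinality of an adjacency resolving set of $G$. -}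

module Defs where

open import Data.Nat using (ℕ; zero; suc; _+_; _≤_)
open import Data.Fin using (Fin; toℕ)
open import Data.Product using (_×_; _,_; Σ; ∃)
open import Data.Sum using (_⊎_)
open import Data.Empty using (⊥)
open import Data.List using (List; length)
open import Data.List.Membership.Propositional using (_∈_)
open import Data.List.Relation.Unary.Unique.Propositional using (Unique)
open import Relation.Nullary using (¬_)
open import Relation.Binary.PropositionalEquality using (_≡_; _≢_)

record Graph (V : Set) : Set₁ where
  field
    Adj     : V → V → Set
    irrefl  : ∀ {u} → ¬ Adj u u
    sym     : ∀ {u v} → Adj u v → Adj v u
open Graph public

PathAdj : (n : ℕ) → Fin n → Fin n → Set
PathAdj n i j = suc (toℕ i) ≡ toℕ j ⊎ suc (toℕ j) ≡ toℕ i

private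
  n≢sucn : ∀ {m : ℕ} → ¬ (suc m ≡ m)
  n≢sucn {zero} ()
  n≢sucn {suc m} p = n≢sucn {m} (cong-pred p)
    where
      cong-pred : ∀ {a b : ℕ} → suc a ≡ suc b → a ≡ b
      cong-pred Relation.Binary.PropositionalEquality.refl = Relation.Binary.PropositionalEquality.refl

P : (n : ℕ) → Graph (Fin n)
P n = record
  { Adj = PathAdj n
  ; irrefl = λ { (Data.Sum.inj₁ p) → n≢sucn p ; (Data.Sum.inj₂ p) → n≢sucn p }
  ; sym = λ { (Data.Sum.inj₁ p) → Data.Sum.inj₂ p ; (Data.Sum.inj₂ p) → Data.Sum.inj₁ p }
  }

□Adj : ∀ {V W} → Graph V → Graph W → V × W → V × W → Set
□Adj G H (u , u') (v , v') =
  (u ≡ v × Adj H u' v') ⊎ (u' ≡ v' × Adj G u v)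

_□_ : ∀ {V W} → Graph V → Graph W → Graph (V × W)
G □ H = record
  { Adj = □Adj G H
  ; irrefl = λ { (Data.Sum.inj₁ (_ , a)) → irrefl H a ; (Data.Sum.inj₂ (_ , a)) → irrefl G a }
  ; sym = λ { (Data.Sum.inj₁ (Relation.Binary.PropositionalEquality.refl , a)) →
                Data.Sum.inj₁ (Relation.Binary.PropositionalEquality.refl , sym H a)
            ; (Data.Sum.inj₂ (Relation.Binary.PropositionalEquality.refl , a)) →
                Data.Sum.inj₂ (Relation.Binary.PropositionalEquality.refl , sym G a) }
  }

-- d₁(u,v) = min(d(u,v), 2): 0 iff u = v, 1 iff u,v adjacent, 2 otherwise.
-- We encode "d₁ z x ≠ d₁ z y" through the relation "d₁ z v = k".
data D₁ {V : Set} (G : Graph V) (z : V) : V → ℕ → Set where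
  d0 : D₁ G z z 0
  d1 : ∀ {v} → Adj G z v → D₁ G z v 1
  d2 : ∀ {v} → z ≢ v → ¬ Adj G z v → D₁ G z v 2

AdjResolving : ∀ {V} → Graph V → List V → Set
AdjResolving G A =
  ∀ x y → x ≢ y →
    Σ _ λ z → z ∈ A × ∀ k l → D₁ G z x k → D₁ G z y l → k ≢ l

IsAdjResolvingSet : ∀ {V} → Graph V → List V → Set
IsAdjResolvingSet G A = Unique A × AdjResolving G A

AdimIs : ∀ {V} → Graph V → ℕ → Set
AdimIs G k =
  (Σ (List _) λ A → IsAdjResolvingSet G A × length A ≡ k) ×
  (∀ A → IsAdjResolvingSet G A → k ≤ length A)

-- Take as landmarks the columns following the 3-periodic pattern ∅, {0,2}, {1}, with a
-- final empty column replaced by {0,2}; this gives n vertices, or n + 1 when n ≡ 1 (mod 3). Every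
-- non-landmark except (1, 0) has a landmark neighbour, and since neighbours lie in adjacent columns,
-- two non-landmarks three or more columns apart are told apart by such a neighbour. Nearby pairs are
-- handled by a finite check on windows of columns, which the periodicity reduces to a few cases.
--
-- For an adjacency resolving set A, two vertices outside A with the same neighbours in A
-- are not resolved. Hence at most one vertex outside A has no neighbour in A, and no two diagonally
-- placed vertices outside A have all their private neighbours outside A. These are local constraints on
-- the column profiles of A. A credit on windows of three consecutive profiles, together with a flag
-- recording whether a vertex without A-neighbours has been seen, drops by at least one per column net
-- of the vertices of A in that column; telescoping over the n columns gives n ≤ |A|.
--
-- The minimum itself exists because resolvability is decidable and there are finitely many candidate
-- sets, the sublists of the vertex list.
module Submission where

open import Defs hiding (sym)
open import Data.Bool using (Bool; true; false; T; not; _∧_; _∨_; _xor_; if_then_else_)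
open import Data.Bool.ListAction using (any; all; and)
open import Data.Bool.Properties using (T-∧; T-∨; T-≡; T-not-≡)
open import Data.Empty using (⊥; ⊥-elim)
open import Data.Fin as Fin using (Fin; toℕ; fromℕ<; #_)
open import Data.Fin.Properties using (toℕ-injective; toℕ<n; toℕ-fromℕ<)
open import Data.List using (List; []; _∷_; _++_; length; map; filter; allFin; cartesianProduct; tabulate; upTo)
open import Data.List.Membership.Propositional using (_∈_; find; lose)
import Data.List.Membership.DecPropositional as DecMembership
open import Data.List.Membership.Propositional.Properties
  using (∈-++⁺ˡ; ∈-++⁺ʳ; ∈-++⁻; ∈-map⁺; ∈-∃++; ∈-filter⁺; ∈-filter⁻; ∈-cartesianProduct⁺; ∈-allFin; ∈-upTo⁺)
open import Data.List.Properties using (length-++; length-++-sucʳ; filter-++; map-tabulate; ++-identityʳ)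
open import Data.List.Relation.Unary.All as All using (All; []; _∷_)
open import Data.List.Relation.Unary.All.Properties using (all⁺; all-filter)
open import Data.List.Relation.Unary.Any using (Any; here; there; any?)
open import Data.List.Relation.Unary.Any.Properties using (any⁺; any⁻)
open import Data.List.Relation.Unary.Unique.Propositional using (Unique; _∷_)
import Data.List.Relation.Unary.Unique.Propositional.Properties as Unique
import Data.List.Relation.Unary.Unique.DecPropositional as DecUnique
open import Data.Nat using (ℕ; zero; suc; _+_; _∸_; _≤_; _<_; z≤n; s≤s; z<s; s<s; _<ᵇ_; _≤ᵇ_; _≡ᵇ_; _%_)
open import Data.Nat.DivMod using ([m+n]%n≡m%n)
import Data.Nat.Properties as ℕₚ
open ℕₚ using (module ≤-Reasoning)
open import Algebra.Properties.CommutativeSemigroup ℕₚ.+-commutativeSemigroup using (interchange; x∙yz≈yx∙z)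
open import Data.List.Extrema ℕₚ.≤-totalOrder using (argmin; argmin-all; f[argmin]≤f[⊤]; f[argmin]≤f[xs])
open import Data.Product using (Σ; _×_; _,_; proj₁; proj₂)
open import Data.Product.Properties using (≡-dec)
open import Data.Sum using (_⊎_; inj₁; inj₂)
open import Data.Unit using (tt)
open import Data.Vec using (Vec; _∷_; [])
open import Function using (_∘_; id; Equivalence; case_of_)
open import Relation.Binary.Definitions using (DecidableEquality)
open import Relation.Binary.PropositionalEquality
  using (_≡_; _≢_; refl; sym; trans; cong; cong₂; subst; subst₂; module ≡-Reasoning)
open import Relation.Nullary using (¬_; Dec; yes; no; does; ¬?)
open import Relation.Nullary.Decidable using (map′; _×-dec_; _⊎-dec_; ⌊_⌋; T?; toWitness; fromWitness)
open import Relation.Unary using (Decidable)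

sublists : {X : Set} → List X → List (List X)
sublists []       = [] ∷ []
sublists (x ∷ xs) = map (x ∷_) (sublists xs) ++ sublists xs

filter∈sublists : ∀ {X : Set} {Q : X → Set} (Q? : Decidable Q) xs → filter Q? xs ∈ sublists xs
filter∈sublists Q? []       = here refl
filter∈sublists Q? (x ∷ xs) with does (Q? x)
... | true  = ∈-++⁺ˡ (∈-map⁺ (x ∷_) (filter∈sublists Q? xs))
... | false = ∈-++⁺ʳ (map (x ∷_) (sublists xs)) (filter∈sublists Q? xs)

∈-++-remove : ∀ {X : Set} (ys₁ : List X) {e x ys₂} → e ∈ ys₁ ++ x ∷ ys₂ → e ≢ x → e ∈ ys₁ ++ ys₂
∈-++-remove ys₁ e∈ e≢x with ∈-++⁻ ys₁ e∈
... | inj₁ e∈ys₁         = ∈-++⁺ˡ e∈ys₁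
... | inj₂ (here e≡x)    = ⊥-elim (e≢x e≡x)
... | inj₂ (there e∈ys₂) = ∈-++⁺ʳ ys₁ e∈ys₂

unique-⊆⇒length≤ : ∀ {X : Set} {xs ys : List X} → Unique xs → (∀ {e} → e ∈ xs → e ∈ ys) → length xs ≤ length ys
unique-⊆⇒length≤ {xs = []}     _            _     = z≤n
unique-⊆⇒length≤ {xs = x ∷ xs} (x∉xs ∷ !xs) xs⊆ys with ∈-∃++ (xs⊆ys (here refl))
... | ys₁ , ys₂ , refl = begin
  suc (length xs)           ≤⟨ s≤s (unique-⊆⇒length≤ !xs xs⊆ys₁++ys₂) ⟩
  suc (length (ys₁ ++ ys₂)) ≡⟨ length-++-sucʳ ys₁ x ys₂ ⟨
  length (ys₁ ++ x ∷ ys₂)   ∎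
  where
    open ≤-Reasoning
    xs⊆ys₁++ys₂ : ∀ {e} → e ∈ xs → e ∈ ys₁ ++ ys₂
    xs⊆ys₁++ys₂ e∈xs = ∈-++-remove ys₁ (xs⊆ys (there e∈xs)) (λ e≡x → All.lookup x∉xs e∈xs (sym e≡x))

bools : List Bool
bools = false ∷ true ∷ []

bools-complete : ∀ b → b ∈ bools
bools-complete false = here refl
bools-complete true  = there (here refl)

indicator : Bool → ℕ
indicator true  = 1
indicator false = 0

and⁻ : ∀ xs → T (and xs) → All T xs
and⁻ []       _ = []
and⁻ (x ∷ xs) t = let tx , txs = Equivalence.to (T-∧ {x}) t in tx ∷ and⁻ xs txs

and⁺ : ∀ {xs} → All T xs → T (and xs)
and⁺ []         = tt
and⁺ (tx ∷ txs) = Equivalence.from T-∧ (tx , and⁺ txs)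

not⁺ : ∀ {x} → ¬ T x → T (not x)
not⁺ {false} _  = tt
not⁺ {true}  ¬t = ¬t tt

not⁻ : ∀ {x} → T (not x) → ¬ T x
not⁻ {false} _ ()

implied : ∀ {x y} → T (not x ∨ y) → T x → T y
implied {true} ty _ = ty

does⇒ : ∀ {P : Set} {P? : Dec P} → T (does P?) → P
does⇒ {P? = yes p} _ = p

xor-cases : ∀ {P Q : Set} (P? : Dec P) (Q? : Dec Q) → T (does P? xor does Q?) → (P × ¬ Q) ⊎ (Q × ¬ P)
xor-cases (yes p) (no ¬q) _ = inj₁ (p , ¬q)
xor-cases (no ¬p) (yes q) _ = inj₂ (q , ¬p)

∑ : ℕ → (ℕ → ℕ) → ℕ
∑ zero    f = 0
∑ (suc m) f = f 0 + ∑ m (f ∘ suc)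

∑-cong : ∀ m {f g : ℕ → ℕ} → (∀ i → i < m → f i ≡ g i) → ∑ m f ≡ ∑ m g
∑-cong zero    f≡g = refl
∑-cong (suc m) f≡g = cong₂ _+_ (f≡g 0 z<s) (∑-cong m (λ i i<m → f≡g (suc i) (s<s i<m)))

∑-+ : ∀ m (f g : ℕ → ℕ) → ∑ m (λ i → f i + g i) ≡ ∑ m f + ∑ m g
∑-+ zero    f g = refl
∑-+ (suc m) f g = trans (cong (f 0 + g 0 +_) (∑-+ m (f ∘ suc) (g ∘ suc))) (interchange (f 0) (g 0) _ _)

telescope : ∀ (w a : ℕ → ℕ) m → (∀ i → i < m → w (suc i) + 1 ≤ a i + w i) → w m + m ≤ ∑ m a + w 0
telescope w a zero    _    = ℕₚ.≤-reflexive (ℕₚ.+-identityʳ (w 0))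
telescope w a (suc m) step = begin
  w (suc m) + suc m           ≡⟨ ℕₚ.+-suc (w (suc m)) m ⟩
  suc (w (suc m) + m)         ≤⟨ s≤s (telescope (w ∘ suc) (a ∘ suc) m (λ i i<m → step (suc i) (s<s i<m))) ⟩
  suc (∑ m (a ∘ suc) + w 1)   ≡⟨ ℕₚ.+-suc (∑ m (a ∘ suc)) (w 1) ⟨
  ∑ m (a ∘ suc) + suc (w 1)   ≡⟨ cong (∑ m (a ∘ suc) +_) (ℕₚ.+-comm 1 (w 1)) ⟩
  ∑ m (a ∘ suc) + (w 1 + 1)   ≤⟨ ℕₚ.+-monoʳ-≤ (∑ m (a ∘ suc)) (step 0 z<s) ⟩
  ∑ m (a ∘ suc) + (a 0 + w 0) ≡⟨ x∙yz≈yx∙z (∑ m (a ∘ suc)) (a 0) (w 0) ⟩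
  a 0 + ∑ m (a ∘ suc) + w 0   ∎
  where open ≤-Reasoning

-- Adjacency resolving sets

module _ {V : Set} (G : Graph V) where

  Separates : V → V → V → Set
  Separates z x y = ∀ k l → D₁ G z x k → D₁ G z y l → k ≢ l

  D₁-functional : ∀ {z v k l} → D₁ G z v k → D₁ G z v l → k ≡ l
  D₁-functional d0         d0         = refl
  D₁-functional d0         (d1 z~z)   = ⊥-elim (irrefl G z~z)
  D₁-functional d0         (d2 z≢z _) = ⊥-elim (z≢z refl)
  D₁-functional (d1 z~z)   d0         = ⊥-elim (irrefl G z~z)
  D₁-functional (d1 _)     (d1 _)     = refl
  D₁-functional (d1 z~v)   (d2 _ z≁v) = ⊥-elim (z≁v z~v)
  D₁-functional (d2 z≢z _) d0         = ⊥-elim (z≢z refl)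
  D₁-functional (d2 _ z≁v) (d1 z~v)   = ⊥-elim (z≁v z~v)
  D₁-functional (d2 _ _)   (d2 _ _)   = refl

  D₁-zero : ∀ {z v} → D₁ G z v 0 → z ≡ v
  D₁-zero d0 = refl

  separates-sym : ∀ {z x y} → Separates z x y → Separates z y x
  separates-sym sep k l p q k≡l = sep l k q p (sym k≡l)

  self-separates : ∀ {x y} → x ≢ y → Separates x x y
  self-separates x≢y k l p q k≡l = x≢y (D₁-zero (subst₂ (D₁ G _) refl (trans (sym k≡l) (D₁-functional p d0)) q))

  neighbour-separates : ∀ {z x y} → z ≢ y → Adj G z x → ¬ Adj G z y → Separates z x y
  neighbour-separates z≢y z~x z≁y k l p q =
    subst₂ _≢_ (sym (D₁-functional p (d1 z~x))) (sym (D₁-functional q (d2 z≢y z≁y))) (λ ())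

  module _ (adj? : ∀ u v → Dec (Adj G u v)) where

    twins-inseparable : ∀ {z x y} → z ≢ x → z ≢ y →
                        (Adj G z x → Adj G z y) → (Adj G z y → Adj G z x) → ¬ Separates z x y
    twins-inseparable {z} {x} z≢x z≢y x→y y→x sep with adj? z x
    ... | yes z~x = sep 1 1 (d1 z~x) (d1 (x→y z~x)) refl
    ... | no  z≁x = sep 2 2 (d2 z≢x z≁x) (d2 z≢y (z≁x ∘ y→x)) refl

    module _ (_≟_ : DecidableEquality V) (vertices : List V) (complete : ∀ v → v ∈ vertices) where

      d₁ : V → V → ℕ
      d₁ z v with z ≟ v | adj? z v
      ... | yes _ | _     = 0
      ... | no _  | yes _ = 1
      ... | no _  | no _  = 2

      D₁-d₁ : ∀ z v → D₁ G z v (d₁ z v)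
      D₁-d₁ z v with z ≟ v | adj? z v
      ... | yes refl | _       = d0
      ... | no z≢v   | yes z~v = d1 z~v
      ... | no z≢v   | no z≁v  = d2 z≢v z≁v

      separates? : ∀ z x y → Dec (Separates z x y)
      separates? z x y = map′ sound (λ sep → sep _ _ (D₁-d₁ z x) (D₁-d₁ z y)) (¬? (d₁ z x ℕₚ.≟ d₁ z y))
        where
          sound : d₁ z x ≢ d₁ z y → Separates z x y
          sound d≢ k l p q k≡l = d≢ (trans (D₁-functional (D₁-d₁ z x) p) (trans k≡l (D₁-functional q (D₁-d₁ z y))))

      resolving? : ∀ A → Dec (AdjResolving G A)
      resolving? A =
        map′ sound complete′
             (All.all? (λ x → All.all? (λ y → (x ≟ y) ⊎-dec any? (λ z → separates? z x y) A) vertices) vertices)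
        where
          Table : Set
          Table = All (λ x → All (λ y → x ≡ y ⊎ Any (λ z → Separates z x y) A) vertices) vertices
          sound : Table → AdjResolving G A
          sound table x y x≢y with All.lookup (All.lookup table (complete x)) (complete y)
          ... | inj₁ x≡y = ⊥-elim (x≢y x≡y)
          ... | inj₂ sep = find sep
          complete′ : AdjResolving G A → Table
          complete′ res = All.tabulate λ {x} _ → All.tabulate λ {y} _ → decide x y
            where
              decide : ∀ x y → x ≡ y ⊎ Any (λ z → Separates z x y) A
              decide x y with x ≟ y
              ... | yes x≡y = inj₁ x≡y
              ... | no x≢y  = let z , z∈A , sep = res x y x≢y in inj₂ (lose z∈A sep)

      adim-exists : Unique vertices → ∀ A₀ → AdjResolving G A₀ → Σ ℕ λ k → AdimIs G k × k ≤ length A₀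
      adim-exists !vertices A₀ res₀ =
        length best , ((best , best-resolves , refl) , best-minimal) ,
        ℕₚ.≤-trans (f[argmin]≤f[⊤] {f = length} (normalise A₀) candidates) (normalise-shorter A₀)
        where
          open DecMembership _≟_ using (_∈?_)
          open DecUnique _≟_ using (unique?)

          normalise : List V → List V
          normalise A = filter (_∈? A) vertices

          normalise-unique : ∀ A → Unique (normalise A)
          normalise-unique A = Unique.filter⁺ (_∈? A) !vertices

          normalise-shorter : ∀ A → length (normalise A) ≤ length A
          normalise-shorter A = unique-⊆⇒length≤ (normalise-unique A) (proj₂ ∘ ∈-filter⁻ (_∈? A) {xs = vertices})

          normalise-resolves : ∀ {A} → AdjResolving G A → IsAdjResolvingSet G (normalise A)
          normalise-resolves {A} res = normalise-unique A , λ x y x≢y →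
            let z , z∈A , sep = res x y x≢y in z , ∈-filter⁺ (_∈? A) (complete z) z∈A , sep

          isResolvingSet? : ∀ S → Dec (IsAdjResolvingSet G S)
          isResolvingSet? S = unique? S ×-dec resolving? S

          candidates : List (List V)
          candidates = filter isResolvingSet? (sublists vertices)

          normalise∈candidates : ∀ {A} → AdjResolving G A → normalise A ∈ candidates
          normalise∈candidates {A} res =
            ∈-filter⁺ isResolvingSet? (filter∈sublists (_∈? A) vertices) (normalise-resolves res)

          best : List V
          best = argmin length (normalise A₀) candidates

          best-resolves : IsAdjResolvingSet G best
          best-resolves = argmin-all length (normalise-resolves res₀) (all-filter isResolvingSet? (sublists vertices))

          best-minimal : ∀ A → IsAdjResolvingSet G A → length best ≤ length A
          best-minimal A (_ , res) =
            ℕₚ.≤-trans (All.lookup (f[argmin]≤f[xs] {f = length} (normalise A₀) candidates) (normalise∈candidates res))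
                       (normalise-shorter A)

-- The grid P₃ □ Pₙ

Cell : ℕ → Set
Cell n = Fin 3 × Fin n

Grid : (n : ℕ) → Graph (Cell n)
Grid n = P 3 □ P n

Position : Set
Position = ℕ × ℕ

pos : ∀ {n} → Cell n → Position
pos (i , j) = toℕ i , toℕ j

_≟ₚ_ : DecidableEquality Position
_≟ₚ_ = ≡-dec ℕₚ._≟_ ℕₚ._≟_

_≟ᶜ_ : ∀ {n} → DecidableEquality (Cell n)
_≟ᶜ_ = ≡-dec Fin._≟_ Fin._≟_

pos-injective : ∀ {n} {u v : Cell n} → pos u ≡ pos v → u ≡ v
pos-injective eq = cong₂ _,_ (toℕ-injective (cong proj₁ eq)) (toℕ-injective (cong proj₂ eq))

pos-inside : ∀ {n} (v : Cell n) → proj₁ (pos v) < 3 × proj₂ (pos v) < n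
pos-inside (i , j) = toℕ<n i , toℕ<n j

cell : ∀ {n} r c → r < 3 → c < n → Cell n
cell r c r<3 c<n = fromℕ< r<3 , fromℕ< c<n

pos-cell : ∀ {n r c} (r<3 : r < 3) (c<n : c < n) → pos (cell r c r<3 c<n) ≡ (r , c)
pos-cell r<3 c<n = cong₂ _,_ (toℕ-fromℕ< r<3) (toℕ-fromℕ< c<n)

Adjacent : Position → Position → Set
Adjacent (a , b) (r , c) = (a ≡ r × (suc b ≡ c ⊎ suc c ≡ b)) ⊎ (b ≡ c × (suc a ≡ r ⊎ suc r ≡ a))

adjacent? : ∀ p q → Dec (Adjacent p q)
adjacent? (a , b) (r , c) =
  (a ℕₚ.≟ r ×-dec (suc b ℕₚ.≟ c ⊎-dec suc c ℕₚ.≟ b)) ⊎-dec (b ℕₚ.≟ c ×-dec (suc a ℕₚ.≟ r ⊎-dec suc r ℕₚ.≟ a))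

Adj⇒Adjacent : ∀ {n} {u v : Cell n} → Adj (Grid n) u v → Adjacent (pos u) (pos v)
Adj⇒Adjacent (inj₁ (refl , j~j′)) = inj₁ (refl , j~j′)
Adj⇒Adjacent (inj₂ (refl , i~i′)) = inj₂ (refl , i~i′)

Adjacent⇒Adj : ∀ {n} {u v : Cell n} → Adjacent (pos u) (pos v) → Adj (Grid n) u v
Adjacent⇒Adj (inj₁ (i≡i′ , j~j′)) = inj₁ (toℕ-injective i≡i′ , j~j′)
Adjacent⇒Adj (inj₂ (j≡j′ , i~i′)) = inj₂ (toℕ-injective j≡j′ , i~i′)

grid-adj? : ∀ {n} (u v : Cell n) → Dec (Adj (Grid n) u v)
grid-adj? u v = map′ Adjacent⇒Adj Adj⇒Adjacent (adjacent? (pos u) (pos v))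

adjacent-column : ∀ {zr zc r c} → Adjacent (zr , zc) (r , c) → zc ≤ suc c × c ≤ suc zc
adjacent-column (inj₁ (_ , inj₁ refl)) = ℕₚ.m≤n⇒m≤1+n (ℕₚ.n≤1+n _) , ℕₚ.≤-refl
adjacent-column (inj₁ (_ , inj₂ refl)) = ℕₚ.≤-refl , ℕₚ.m≤n⇒m≤1+n (ℕₚ.n≤1+n _)
adjacent-column (inj₂ (refl , _))      = ℕₚ.n≤1+n _ , ℕₚ.n≤1+n _

column-gap : ∀ {z r c r′ c′} → c + 3 ≤ c′ → Adjacent z (r , c) → ¬ Adjacent z (r′ , c′)
column-gap {c = c} {c′ = c′} gap z~p z~q =
  ℕₚ.<⇒≱ (ℕₚ.≤-trans (s≤s (proj₂ (adjacent-column z~q))) (s≤s (s≤s (proj₁ (adjacent-column z~p)))))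
         (subst (_≤ c′) (ℕₚ.+-comm c 3) gap)

cells : (n : ℕ) → List (Cell n)
cells n = cartesianProduct (allFin 3) (allFin n)

cells-complete : ∀ {n} (v : Cell n) → v ∈ cells n
cells-complete (i , j) = ∈-cartesianProduct⁺ (∈-allFin i) (∈-allFin j)

cells-unique : ∀ n → Unique (cells n)
cells-unique n = Unique.cartesianProduct⁺ (Unique.allFin⁺ 3) (Unique.allFin⁺ n)

columnCount : (Position → Bool) → ℕ → ℕ
columnCount p c = indicator (p (0 , c)) + (indicator (p (1 , c)) + indicator (p (2 , c)))

length-filter-∷ : ∀ {X : Set} (q : X → Bool) x xs →
                  length (filter (T? ∘ q) (x ∷ xs)) ≡ indicator (q x) + length (filter (T? ∘ q) xs)
length-filter-∷ q x xs with q x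
... | true  = refl
... | false = refl

length-filter-tabulate : ∀ {X : Set} {m} (h : Fin m → X) (q : X → Bool) (f : ℕ → ℕ) →
                         (∀ i → indicator (q (h i)) ≡ f (toℕ i)) → length (filter (T? ∘ q) (tabulate h)) ≡ ∑ m f
length-filter-tabulate {m = zero}  h q f q≡f = refl
length-filter-tabulate {m = suc m} h q f q≡f =
  trans (length-filter-∷ q (h Fin.zero) _)
        (cong₂ _+_ (q≡f Fin.zero) (length-filter-tabulate (h ∘ Fin.suc) q (f ∘ suc) (q≡f ∘ Fin.suc)))

length-filter-++ : ∀ {X : Set} {Q : X → Set} (Q? : Decidable Q) xs ys →
                   length (filter Q? (xs ++ ys)) ≡ length (filter Q? xs) + length (filter Q? ys)
length-filter-++ Q? xs ys = trans (cong length (filter-++ Q? xs ys)) (length-++ (filter Q? xs))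

count-cells : ∀ n (p : Position → Bool) → length (filter (T? ∘ p ∘ pos) (cells n)) ≡ ∑ n (columnCount p)
count-cells n p = begin
  length (filter q? (row (# 0) ++ row (# 1) ++ row (# 2) ++ []))
    ≡⟨ length-filter-++ q? (row (# 0)) _ ⟩
  length (filter q? (row (# 0))) + length (filter q? (row (# 1) ++ row (# 2) ++ []))
    ≡⟨ cong (length (filter q? (row (# 0))) +_) (length-filter-++ q? (row (# 1)) _) ⟩
  length (filter q? (row (# 0))) + (length (filter q? (row (# 1))) + length (filter q? (row (# 2) ++ [])))
    ≡⟨ cong₂ _+_ (rowCount (# 0)) (cong₂ _+_ (rowCount (# 1)) last-row) ⟩
  ∑ n (indicatorAt 0) + (∑ n (indicatorAt 1) + ∑ n (indicatorAt 2))
    ≡⟨ cong (∑ n (indicatorAt 0) +_) (∑-+ n _ _) ⟨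
  ∑ n (indicatorAt 0) + ∑ n (λ c → indicatorAt 1 c + indicatorAt 2 c)
    ≡⟨ ∑-+ n _ _ ⟨
  ∑ n (columnCount p) ∎
  where
    open ≡-Reasoning
    q? : Decidable (T ∘ p ∘ pos)
    q? = T? ∘ p ∘ pos
    indicatorAt : ℕ → ℕ → ℕ
    indicatorAt r c = indicator (p (r , c))
    row : Fin 3 → List (Cell n)
    row i = map (i ,_) (allFin n)
    rowCount : ∀ i → length (filter q? (row i)) ≡ ∑ n (indicatorAt (toℕ i))
    rowCount i = trans (cong (length ∘ filter q?) (map-tabulate id (i ,_)))
                       (length-filter-tabulate {m = n} (i ,_) (p ∘ pos) (indicatorAt (toℕ i)) (λ _ → refl))
    last-row : length (filter q? (row (# 2) ++ [])) ≡ ∑ n (indicatorAt 2)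
    last-row = trans (cong (length ∘ filter q?) (++-identityʳ (row (# 2)))) (rowCount (# 2))

occupied : ∀ {n} → List (Cell n) → Position → Bool
occupied A p = any (λ v → ⌊ pos v ≟ₚ p ⌋) A

∈⇒occupied : ∀ {n} {A : List (Cell n)} {v} → v ∈ A → T (occupied A (pos v))
∈⇒occupied v∈A = any⁺ _ (lose v∈A (fromWitness refl))

occupied⇒∈ : ∀ {n} {A : List (Cell n)} {p} → T (occupied A p) → Σ (Cell n) λ v → v ∈ A × pos v ≡ p
occupied⇒∈ {A = A} occ = let v , v∈A , eq = find (any⁻ _ A occ) in v , v∈A , toWitness eq

occupied⇒inside : ∀ {n} {A : List (Cell n)} {r c} → T (occupied A (r , c)) → r < 3 × c < n
occupied⇒inside {A = A} {r} {c} occ with occupied⇒∈ {A = A} {p = r , c} occ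
... | v , _ , refl = pos-inside v

Neighbourhood⊆ : ∀ {n} → List (Cell n) → Position → Position → Set
Neighbourhood⊆ A p q = ∀ z → T (occupied A z) → Adjacent z p → Adjacent z q

no-twins : ∀ {n} {A : List (Cell n)} → AdjResolving (Grid n) A → ∀ {x y : Cell n} {p q} → pos x ≡ p → pos y ≡ q → p ≢ q →
           ¬ T (occupied A p) → ¬ T (occupied A q) → Neighbourhood⊆ A p q → Neighbourhood⊆ A q p → ⊥
no-twins {n} {A} resolving {x} {y} refl refl p≢q x∉A y∉A x⊆y y⊆x with resolving x y (p≢q ∘ cong pos)
... | z , z∈A , separates =
  twins-inseparable (Grid n) grid-adj? (z≢ x∉A) (z≢ y∉A)
    (Adjacent⇒Adj ∘ x⊆y (pos z) (∈⇒occupied z∈A) ∘ Adj⇒Adjacent)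
    (Adjacent⇒Adj ∘ y⊆x (pos z) (∈⇒occupied z∈A) ∘ Adj⇒Adjacent)
    separates
  where
    z≢ : ∀ {w} → ¬ T (occupied A (pos w)) → z ≢ w
    z≢ w∉A refl = w∉A (∈⇒occupied z∈A)

-- Lower bound

-- The cells of one column that lie in a vertex set, or a wall beyond either end of the grid.
data Profile : Set where
  wall    : Profile
  ⟨_,_,_⟩ : Bool → Bool → Bool → Profile

fromBits : Bool × Bool × Bool → Profile
fromBits (x , y , z) = ⟨ x , y , z ⟩

profiles : List Profile
profiles = wall ∷ map fromBits (cartesianProduct bools (cartesianProduct bools bools))

profiles-complete : ∀ p → p ∈ profiles
profiles-complete wall          = here refl
profiles-complete ⟨ x , y , z ⟩ =
  there (∈-map⁺ fromBits
    (∈-cartesianProduct⁺ (bools-complete x) (∈-cartesianProduct⁺ (bools-complete y) (bools-complete z))))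

isWall : Profile → Bool
isWall wall          = true
isWall ⟨ _ , _ , _ ⟩ = false

bit : ℕ → Profile → Bool
bit _ wall          = false
bit 0 ⟨ x , _ , _ ⟩ = x
bit 1 ⟨ _ , y , _ ⟩ = y
bit 2 ⟨ _ , _ , z ⟩ = z
bit _ ⟨ _ , _ , _ ⟩ = false

size : Profile → ℕ
size wall          = 0
size ⟨ x , y , z ⟩ = indicator x + (indicator y + indicator z)

-- In the window predicates below the profiles a, b, c, d are those of columns i − 1, i, i + 1, i + 2.
-- descendingTwins r says that (r, i) and (r + 1, i + 1) are vacant and so are their private neighbours
-- (r − 1, i), (r, i − 1), (r + 2, i + 1), (r + 1, i + 2); ascendingTwins r says the same of (r + 1, i)
-- and (r, i + 1). Row r ∸ 1 stands for the row above r; for r = 0 it is row r itself, which is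
-- already required to be vacant, so the condition is then vacuous.

vacant : ℕ → Profile → Bool
vacant r p = and (not (isWall p) ∷ not (bit r p) ∷ [])

isolated : ℕ → Profile → Profile → Profile → Bool
isolated r a b c = and (vacant r b ∷ not (bit (r ∸ 1) b) ∷ not (bit (suc r) b) ∷ not (bit r a) ∷ not (bit r c) ∷ [])

someIsolated : Profile → Profile → Profile → Bool
someIsolated a b c = isolated 0 a b c ∨ isolated 1 a b c ∨ isolated 2 a b c

descendingTwins : ℕ → Profile → Profile → Profile → Profile → Bool
descendingTwins r a b c d = and (vacant r b ∷ vacant (suc r) c ∷
  not (bit (r ∸ 1) b) ∷ not (bit r a) ∷ not (bit (2 + r) c) ∷ not (bit (suc r) d) ∷ [])

ascendingTwins : ℕ → Profile → Profile → Profile → Profile → Bool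
ascendingTwins r a b c d = and (vacant (suc r) b ∷ vacant r c ∷
  not (bit (suc r) a) ∷ not (bit (2 + r) b) ∷ not (bit (r ∸ 1) c) ∷ not (bit r d) ∷ [])

atMostOne : Bool → Bool → Bool → Bool → Bool
atMostOne x y z f = and (not (x ∧ y) ∷ not (x ∧ z) ∷ not (y ∧ z) ∷ not (f ∧ (x ∨ y ∨ z)) ∷ [])

admissible : Profile → Profile → Profile → Profile → Bool → Bool
admissible a b c d f = and (not (isWall b) ∷ (not (isWall c) ∨ isWall d) ∷
  not (descendingTwins 0 a b c d) ∷ not (descendingTwins 1 a b c d) ∷
  not (ascendingTwins 0 a b c d) ∷ not (ascendingTwins 1 a b c d) ∷
  atMostOne (isolated 0 a b c) (isolated 1 a b c) (isolated 2 a b c) f ∷ [])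

select : {X : Set} → Bool → Bool → Bool → Vec X 8 → X
select false false false (v ∷ _)                             = v
select false false true  (_ ∷ v ∷ _)                         = v
select false true  false (_ ∷ _ ∷ v ∷ _)                     = v
select false true  true  (_ ∷ _ ∷ _ ∷ v ∷ _)                 = v
select true  false false (_ ∷ _ ∷ _ ∷ _ ∷ v ∷ _)             = v
select true  false true  (_ ∷ _ ∷ _ ∷ _ ∷ _ ∷ v ∷ _)         = v
select true  true  false (_ ∷ _ ∷ _ ∷ _ ∷ _ ∷ _ ∷ v ∷ _)     = v
select true  true  true  (_ ∷ _ ∷ _ ∷ _ ∷ _ ∷ _ ∷ _ ∷ v ∷ _) = v

-- The credit was found by a shortest-path computation over the admissible windows; certificate checks
-- by evaluation that it decreases as required. Row and column of baseCredit f are the first two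
-- profiles of the window, read as binary numbers.

baseCredit : Bool → Vec (Vec ℕ 8) 8
baseCredit false =
  (1 ∷ 1 ∷ 1 ∷ 1 ∷ 1 ∷ 1 ∷ 1 ∷ 0 ∷ []) ∷
  (2 ∷ 2 ∷ 2 ∷ 2 ∷ 2 ∷ 1 ∷ 1 ∷ 1 ∷ []) ∷
  (2 ∷ 2 ∷ 1 ∷ 1 ∷ 2 ∷ 1 ∷ 1 ∷ 1 ∷ []) ∷
  (2 ∷ 2 ∷ 2 ∷ 2 ∷ 2 ∷ 2 ∷ 2 ∷ 2 ∷ []) ∷
  (2 ∷ 2 ∷ 2 ∷ 1 ∷ 2 ∷ 1 ∷ 2 ∷ 1 ∷ []) ∷
  (2 ∷ 2 ∷ 2 ∷ 2 ∷ 2 ∷ 2 ∷ 2 ∷ 2 ∷ []) ∷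
  (2 ∷ 2 ∷ 2 ∷ 2 ∷ 2 ∷ 2 ∷ 2 ∷ 2 ∷ []) ∷
  (2 ∷ 2 ∷ 2 ∷ 2 ∷ 2 ∷ 2 ∷ 2 ∷ 2 ∷ []) ∷ []
baseCredit true =
  (1 ∷ 1 ∷ 1 ∷ 0 ∷ 1 ∷ 0 ∷ 0 ∷ 0 ∷ []) ∷
  (1 ∷ 1 ∷ 1 ∷ 1 ∷ 1 ∷ 1 ∷ 1 ∷ 1 ∷ []) ∷
  (1 ∷ 1 ∷ 1 ∷ 1 ∷ 1 ∷ 0 ∷ 1 ∷ 0 ∷ []) ∷
  (1 ∷ 1 ∷ 1 ∷ 1 ∷ 1 ∷ 1 ∷ 1 ∷ 1 ∷ []) ∷
  (1 ∷ 1 ∷ 1 ∷ 0 ∷ 1 ∷ 1 ∷ 1 ∷ 0 ∷ []) ∷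
  (1 ∷ 1 ∷ 1 ∷ 1 ∷ 1 ∷ 1 ∷ 1 ∷ 1 ∷ []) ∷
  (2 ∷ 1 ∷ 1 ∷ 1 ∷ 1 ∷ 1 ∷ 1 ∷ 1 ∷ []) ∷
  (2 ∷ 2 ∷ 2 ∷ 2 ∷ 2 ∷ 2 ∷ 2 ∷ 2 ∷ []) ∷ []

discounted : Bool → Profile → Profile → Profile → Bool
discounted false ⟨ false , false , true ⟩  ⟨ true , false , false ⟩  c = bit 1 c ∧ bit 2 c
discounted false ⟨ false , true , false ⟩  ⟨ false , false , false ⟩ c = bit 1 c
discounted false ⟨ false , true , false ⟩  ⟨ false , false , true ⟩  c = bit 1 c
discounted false ⟨ false , true , false ⟩  ⟨ true , false , false ⟩  c = bit 1 c
discounted false ⟨ true , false , false ⟩  ⟨ false , false , true ⟩  c = bit 0 c ∧ bit 1 c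
discounted true  ⟨ false , false , false ⟩ ⟨ false , true , false ⟩  c = bit 0 c ∧ bit 2 c
discounted true  ⟨ false , false , false ⟩ ⟨ true , false , false ⟩  c = bit 1 c
discounted true  ⟨ true , true , false ⟩   ⟨ false , false , false ⟩ c = bit 1 c
discounted _     _                         _                         _ = false

credit : Profile → Profile → Profile → Bool → ℕ
credit a@(⟨ a₀ , a₁ , a₂ ⟩) b@(⟨ b₀ , b₁ , b₂ ⟩) c f =
  select b₀ b₁ b₂ (select a₀ a₁ a₂ (baseCredit f)) ∸ indicator (discounted f a b c)
credit _ _ _ _ = 1

credit-wall : ∀ a c f → credit a wall c f ≡ 1
credit-wall wall          c f = refl
credit-wall ⟨ _ , _ , _ ⟩ c f = refl

Window : Set
Window = Profile × Profile × Profile × Profile × Bool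

windows : List Window
windows = cartesianProduct profiles (cartesianProduct profiles (cartesianProduct profiles (cartesianProduct profiles bools)))

creditDrops : Window → Bool
creditDrops (a , b , c , d , f) =
  not (admissible a b c d f) ∨ (credit b c d (f ∨ someIsolated a b c) + 1 ≤ᵇ size b + credit a b c f)

certificate : All (T ∘ creditDrops) windows
certificate = all⁺ creditDrops windows tt

credit-decreases : ∀ a b c d f → T (admissible a b c d f) →
                   credit b c d (f ∨ someIsolated a b c) + 1 ≤ size b + credit a b c f
credit-decreases a b c d f admissible-window =
  ℕₚ.≤ᵇ⇒≤ _ _ (implied (All.lookup certificate window∈windows) admissible-window)
  where
    window∈windows : (a , b , c , d , f) ∈ windows
    window∈windows =
      ∈-cartesianProduct⁺ (profiles-complete a) (∈-cartesianProduct⁺ (profiles-complete b)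
        (∈-cartesianProduct⁺ (profiles-complete c) (∈-cartesianProduct⁺ (profiles-complete d) (bools-complete f))))

module LowerBound {n} (A : List (Cell n)) (resolving : AdjResolving (Grid n) A) where

  Occupied : ℕ → ℕ → Set
  Occupied r c = T (occupied A (r , c))

  occupied-inside : ∀ {r c} → Occupied r c → r < 3 × c < n
  occupied-inside = occupied⇒inside {A = A}

  unoccupied : ∀ {r c} → ¬ Occupied r c → occupied A (r , c) ≡ false
  unoccupied = Equivalence.to T-not-≡ ∘ not⁺

  -- profile (1 + c) is the profile of column c, so that a window may start one column before the grid.
  profile : ℕ → Profile
  profile zero    = wall
  profile (suc c) = if c <ᵇ n then ⟨ occupied A (0 , c) , occupied A (1 , c) , occupied A (2 , c) ⟩ else wall

  profile-inside : ∀ c → c < n → profile (suc c) ≡ ⟨ occupied A (0 , c) , occupied A (1 , c) , occupied A (2 , c) ⟩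
  profile-inside c c<n rewrite Equivalence.to T-≡ (ℕₚ.<⇒<ᵇ c<n) = refl

  profile-beyond : ∀ c → n ≤ c → profile (suc c) ≡ wall
  profile-beyond c n≤c rewrite Equivalence.to T-not-≡ (not⁺ λ c<ᵇn → ℕₚ.<⇒≱ (ℕₚ.<ᵇ⇒< c n c<ᵇn) n≤c) = refl

  not-wall : ∀ c → c < n → T (not (isWall (profile (suc c))))
  not-wall c c<n = subst (T ∘ not ∘ isWall) (sym (profile-inside c c<n)) tt

  inside : ∀ c → T (not (isWall (profile (suc c)))) → c < n
  inside c t with c ℕₚ.<? n
  ... | yes c<n = c<n
  ... | no  c≮n = ⊥-elim (subst (T ∘ not ∘ isWall) (profile-beyond c (ℕₚ.≮⇒≥ c≮n)) t)

  bit-profile : ∀ r c → bit r (profile (suc c)) ≡ occupied A (r , c)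
  bit-profile r c with c ℕₚ.<? n
  ... | yes c<n rewrite profile-inside c c<n = bit-column r
    where
      bit-column : ∀ r → bit r ⟨ occupied A (0 , c) , occupied A (1 , c) , occupied A (2 , c) ⟩ ≡ occupied A (r , c)
      bit-column 0 = refl
      bit-column 1 = refl
      bit-column 2 = refl
      bit-column (suc (suc (suc r))) = sym (unoccupied λ occ → ℕₚ.<⇒≱ (proj₁ (occupied-inside occ)) (s≤s (s≤s (s≤s z≤n))))
  ... | no  c≮n rewrite profile-beyond c (ℕₚ.≮⇒≥ c≮n) = sym (unoccupied λ occ → c≮n (proj₂ (occupied-inside occ)))

  free : ∀ r c → T (not (bit r (profile (suc c)))) → ¬ Occupied r c
  free r c = not⁻ ∘ subst (T ∘ not) (bit-profile r c)

  free-left : ∀ r c → T (not (bit r (profile c))) → ∀ c₀ → suc c₀ ≡ c → ¬ Occupied r c₀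
  free-left r .(suc c₀) t c₀ refl = free r c₀ t

  free-above : ∀ r c → T (not (bit (r ∸ 1) (profile (suc c)))) → ∀ r₀ → suc r₀ ≡ r → ¬ Occupied r₀ c
  free-above .(suc r₀) c t r₀ refl = free r₀ c t

  vacant-cell : ∀ r c → T (vacant r (profile (suc c))) → c < n × ¬ Occupied r c
  vacant-cell r c t with and⁻ (_ ∷ _ ∷ []) t
  ... | real ∷ clear ∷ [] = inside c real , free r c clear

  descending-⊆ : ∀ {r c} → (∀ c₀ → suc c₀ ≡ c → ¬ Occupied r c₀) → (∀ r₀ → suc r₀ ≡ r → ¬ Occupied r₀ c) →
                 Neighbourhood⊆ A (r , c) (suc r , suc c)
  descending-⊆ left above (_ , zc) occ (inj₁ (refl , inj₁ eq))   = ⊥-elim (left zc eq occ)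
  descending-⊆ left above _        occ (inj₁ (refl , inj₂ refl)) = inj₂ (refl , inj₁ refl)
  descending-⊆ left above (zr , _) occ (inj₂ (refl , inj₁ eq))   = ⊥-elim (above zr eq occ)
  descending-⊆ left above _        occ (inj₂ (refl , inj₂ refl)) = inj₁ (refl , inj₁ refl)

  descending-⊇ : ∀ {r c} → ¬ Occupied (suc r) (2 + c) → ¬ Occupied (2 + r) (suc c) →
                 Neighbourhood⊆ A (suc r , suc c) (r , c)
  descending-⊇ right below _ occ (inj₁ (refl , inj₁ refl)) = inj₂ (refl , inj₂ refl)
  descending-⊇ right below _ occ (inj₁ (refl , inj₂ refl)) = ⊥-elim (right occ)
  descending-⊇ right below _ occ (inj₂ (refl , inj₁ refl)) = inj₁ (refl , inj₂ refl)
  descending-⊇ right below _ occ (inj₂ (refl , inj₂ refl)) = ⊥-elim (below occ)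

  ascending-⊆ : ∀ {r c} → (∀ c₀ → suc c₀ ≡ c → ¬ Occupied (suc r) c₀) → ¬ Occupied (2 + r) c →
                Neighbourhood⊆ A (suc r , c) (r , suc c)
  ascending-⊆ left below (_ , zc) occ (inj₁ (refl , inj₁ eq))   = ⊥-elim (left zc eq occ)
  ascending-⊆ left below _        occ (inj₁ (refl , inj₂ refl)) = inj₂ (refl , inj₂ refl)
  ascending-⊆ left below _        occ (inj₂ (refl , inj₁ refl)) = inj₁ (refl , inj₁ refl)
  ascending-⊆ left below _        occ (inj₂ (refl , inj₂ refl)) = ⊥-elim (below occ)

  ascending-⊇ : ∀ {r c} → ¬ Occupied r (2 + c) → (∀ r₀ → suc r₀ ≡ r → ¬ Occupied r₀ (suc c)) →
                Neighbourhood⊆ A (r , suc c) (suc r , c)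
  ascending-⊇ right above _        occ (inj₁ (refl , inj₁ refl)) = inj₂ (refl , inj₁ refl)
  ascending-⊇ right above _        occ (inj₁ (refl , inj₂ refl)) = ⊥-elim (right occ)
  ascending-⊇ right above (zr , _) occ (inj₂ (refl , inj₁ eq))   = ⊥-elim (above zr eq occ)
  ascending-⊇ right above _        occ (inj₂ (refl , inj₂ refl)) = inj₁ (refl , inj₂ refl)

  twins-at : ∀ {r c r′ c′} → r < 3 → c < n → r′ < 3 → c′ < n → (r , c) ≢ (r′ , c′) →
             ¬ Occupied r c → ¬ Occupied r′ c′ → Neighbourhood⊆ A (r , c) (r′ , c′) → Neighbourhood⊆ A (r′ , c′) (r , c) → ⊥
  twins-at r<3 c<n r′<3 c′<n = no-twins resolving (pos-cell r<3 c<n) (pos-cell r′<3 c′<n)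

  no-descending-twins : ∀ r i → r < 2 →
                        ¬ T (descendingTwins r (profile i) (profile (suc i)) (profile (2 + i)) (profile (3 + i)))
  no-descending-twins r i r<2 t with and⁻ (_ ∷ _ ∷ _ ∷ _ ∷ _ ∷ _ ∷ []) t
  ... | vx ∷ vy ∷ above ∷ left ∷ below ∷ right ∷ [] =
    twins-at (ℕₚ.m≤n⇒m≤1+n r<2) (proj₁ x) (s≤s r<2) (proj₁ y) (ℕₚ.1+n≢n ∘ sym ∘ cong proj₁) (proj₂ x) (proj₂ y)
      (descending-⊆ (free-left r i left) (free-above r i above))
      (descending-⊇ (free (suc r) (2 + i) right) (free (2 + r) (suc i) below))
    where
      x : i < n × ¬ Occupied r i
      x = vacant-cell r i vx
      y : suc i < n × ¬ Occupied (suc r) (suc i)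
      y = vacant-cell (suc r) (suc i) vy

  no-ascending-twins : ∀ r i → r < 2 →
                       ¬ T (ascendingTwins r (profile i) (profile (suc i)) (profile (2 + i)) (profile (3 + i)))
  no-ascending-twins r i r<2 t with and⁻ (_ ∷ _ ∷ _ ∷ _ ∷ _ ∷ _ ∷ []) t
  ... | vx ∷ vy ∷ left ∷ below ∷ above ∷ right ∷ [] =
    twins-at (s≤s r<2) (proj₁ x) (ℕₚ.m≤n⇒m≤1+n r<2) (proj₁ y) (ℕₚ.1+n≢n ∘ cong proj₁) (proj₂ x) (proj₂ y)
      (ascending-⊆ (free-left (suc r) i left) (free (2 + r) i below))
      (ascending-⊇ (free r (2 + i) right) (free-above r (suc i) above))
    where
      x : i < n × ¬ Occupied (suc r) i
      x = vacant-cell (suc r) i vx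
      y : suc i < n × ¬ Occupied r (suc i)
      y = vacant-cell r (suc i) vy

  Isolated : ℕ → ℕ → Set
  Isolated r c = r < 3 × c < n × ¬ Occupied r c × (∀ z → T (occupied A z) → ¬ Adjacent z (r , c))

  isolated-unique : ∀ {r c r′ c′} → Isolated r c → Isolated r′ c′ → (r , c) ≡ (r′ , c′)
  isolated-unique {r} {c} {r′} {c′} (r<3 , c<n , x∉A , x-alone) (r′<3 , c′<n , y∉A , y-alone) with (r , c) ≟ₚ (r′ , c′)
  ... | yes x≡y = x≡y
  ... | no  x≢y = ⊥-elim (twins-at r<3 c<n r′<3 c′<n x≢y x∉A y∉A
                            (λ z occ z~x → ⊥-elim (x-alone z occ z~x)) (λ z occ z~y → ⊥-elim (y-alone z occ z~y)))

  isolatedAt : ℕ → ℕ → Bool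
  isolatedAt r i = isolated r (profile i) (profile (suc i)) (profile (2 + i))

  someIsolatedAt : ℕ → Bool
  someIsolatedAt i = someIsolated (profile i) (profile (suc i)) (profile (2 + i))

  isolated-cell : ∀ r i → r < 3 → T (isolatedAt r i) → Isolated r i
  isolated-cell r i r<3 t with and⁻ (_ ∷ _ ∷ _ ∷ _ ∷ _ ∷ []) t
  ... | vx ∷ above ∷ below ∷ left ∷ right ∷ [] = r<3 , proj₁ x , proj₂ x , alone
    where
      x : i < n × ¬ Occupied r i
      x = vacant-cell r i vx
      alone : ∀ z → T (occupied A z) → ¬ Adjacent z (r , i)
      alone (_ , zc) occ (inj₁ (refl , inj₁ eq))   = free-left r i left zc eq occ
      alone _        occ (inj₁ (refl , inj₂ refl)) = free r (suc i) right occ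
      alone (zr , _) occ (inj₂ (refl , inj₁ eq))   = free-above r i above zr eq occ
      alone _        occ (inj₂ (refl , inj₂ refl)) = free (suc r) i below occ

  someIsolated-cell : ∀ i → T (someIsolatedAt i) → Σ ℕ λ r → Isolated r i
  someIsolated-cell i t with Equivalence.to T-∨ t
  ... | inj₁ t₀ = 0 , isolated-cell 0 i z<s t₀
  ... | inj₂ t₁₂ with Equivalence.to T-∨ t₁₂
  ... | inj₁ t₁ = 1 , isolated-cell 1 i (s<s z<s) t₁
  ... | inj₂ t₂ = 2 , isolated-cell 2 i (s<s (s<s z<s)) t₂

  seen : ℕ → Bool
  seen zero    = false
  seen (suc i) = seen i ∨ someIsolatedAt i

  seen-cell : ∀ i → T (seen i) → Σ ℕ λ r → Σ ℕ λ c → c < i × Isolated r c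
  seen-cell (suc i) t with Equivalence.to T-∨ t
  ... | inj₁ earlier = let r , c , c<i , iso = seen-cell i earlier in r , c , ℕₚ.m≤n⇒m≤1+n c<i , iso
  ... | inj₂ now     = let r , iso = someIsolated-cell i now in r , i , ℕₚ.n<1+n i , iso

  at-most-one-isolated : ∀ i → T (atMostOne (isolatedAt 0 i) (isolatedAt 1 i) (isolatedAt 2 i) (seen i))
  at-most-one-isolated i =
    and⁺ (not⁺ (same-column z<s (s<s z<s) (λ ())) ∷ not⁺ (same-column z<s (s<s (s<s z<s)) (λ ())) ∷
          not⁺ (same-column (s<s z<s) (s<s (s<s z<s)) (λ ())) ∷ not⁺ earlier-column ∷ [])
    where
      same-column : ∀ {r r′} → r < 3 → r′ < 3 → r ≢ r′ → ¬ T (isolatedAt r i ∧ isolatedAt r′ i)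
      same-column {r} {r′} r<3 r′<3 r≢r′ t =
        let tr , tr′ = Equivalence.to T-∧ t
        in r≢r′ (cong proj₁ (isolated-unique (isolated-cell r i r<3 tr) (isolated-cell r′ i r′<3 tr′)))
      earlier-column : ¬ T (seen i ∧ someIsolatedAt i)
      earlier-column t =
        let earlier , now = Equivalence.to T-∧ t
            _ , c , c<i , iso = seen-cell i earlier
            _ , iso′ = someIsolated-cell i now
        in ℕₚ.<⇒≢ c<i (cong proj₂ (isolated-unique iso iso′))

  admissible-window : ∀ i → i < n → T (admissible (profile i) (profile (suc i)) (profile (2 + i)) (profile (3 + i)) (seen i))
  admissible-window i i<n = and⁺ (
    not-wall i i<n ∷ walls-persist ∷
    not⁺ (no-descending-twins 0 i z<s) ∷ not⁺ (no-descending-twins 1 i (s<s z<s)) ∷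
    not⁺ (no-ascending-twins 0 i z<s) ∷ not⁺ (no-ascending-twins 1 i (s<s z<s)) ∷
    at-most-one-isolated i ∷ [])
    where
      walls-persist : T (not (isWall (profile (2 + i))) ∨ isWall (profile (3 + i)))
      walls-persist with suc i ℕₚ.<? n
      ... | yes 1+i<n = Equivalence.from T-∨ (inj₁ (not-wall (suc i) 1+i<n))
      ... | no  1+i≮n = Equivalence.from T-∨ (inj₂ (subst (T ∘ isWall) (sym (profile-beyond (2 + i) n≤2+i)) tt))
        where
          n≤2+i : n ≤ 2 + i
          n≤2+i = ℕₚ.m≤n⇒m≤1+n (ℕₚ.≮⇒≥ 1+i≮n)

  occupancy-bound : ∑ n (λ c → size (profile (suc c))) ≤ length A
  occupancy-bound = begin
    ∑ n (λ c → size (profile (suc c)))     ≡⟨ ∑-cong n (λ c c<n → cong size (profile-inside c c<n)) ⟩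
    ∑ n (columnCount (occupied A))         ≡⟨ count-cells n (occupied A) ⟨
    length (filter occupied? (cells n))    ≤⟨ unique-⊆⇒length≤ (Unique.filter⁺ occupied? (cells-unique n)) occupied⊆A ⟩
    length A                               ∎
    where
      open ≤-Reasoning
      occupied? : Decidable (T ∘ occupied A ∘ pos)
      occupied? = T? ∘ occupied A ∘ pos
      occupied⊆A : ∀ {v} → v ∈ filter occupied? (cells n) → v ∈ A
      occupied⊆A v∈ with occupied⇒∈ {A = A} (proj₂ (∈-filter⁻ occupied? {xs = cells n} v∈))
      ... | w , w∈A , pos-w≡pos-v = subst (_∈ A) (pos-injective pos-w≡pos-v) w∈A

  creditAt : ℕ → ℕ
  creditAt i = credit (profile i) (profile (suc i)) (profile (2 + i)) (seen i)

  creditAt-end : creditAt n ≡ 1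
  creditAt-end = trans (cong (λ b → credit (profile n) b (profile (2 + n)) (seen n)) (profile-beyond n ℕₚ.≤-refl))
                       (credit-wall (profile n) (profile (2 + n)) (seen n))

  lower-bound : n ≤ length A
  lower-bound = ℕₚ.≤-pred (begin
    suc n                                    ≡⟨ cong (_+ n) creditAt-end ⟨
    creditAt n + n                           ≤⟨ telescope creditAt (λ c → size (profile (suc c))) n step ⟩
    ∑ n (λ c → size (profile (suc c))) + 1   ≤⟨ ℕₚ.+-monoˡ-≤ 1 occupancy-bound ⟩
    length A + 1                             ≡⟨ ℕₚ.+-comm (length A) 1 ⟩
    suc (length A)                           ∎)
    where
      open ≤-Reasoning
      step : ∀ i → i < n → creditAt (suc i) + 1 ≤ size (profile (suc i)) + creditAt i
      step i i<n = credit-decreases (profile i) (profile (suc i)) (profile (2 + i)) (profile (3 + i)) (seen i)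
                                    (admissible-window i i<n)

-- Upper bound

data Kind : Set where
  empty pair middle : Kind

kind : ℕ → Kind
kind 0                   = empty
kind 1                   = pair
kind 2                   = middle
kind (suc (suc (suc c))) = kind c

finish : Kind → Bool → Kind
finish empty  true  = pair
finish empty  false = empty
finish pair   _     = pair
finish middle _     = middle

columnKind : ℕ → ℕ → Kind
columnKind n c = finish (kind c) (suc c ≡ᵇ n)

selects : Kind → ℕ → Bool
selects pair   0 = true
selects pair   2 = true
selects middle 1 = true
selects _      _ = false

landmark : ℕ → Position → Bool
landmark n (r , c) = (c <ᵇ n) ∧ selects (columnKind n c) r

landmarks : (n : ℕ) → List (Cell n)
landmarks n = filter (T? ∘ landmark n ∘ pos) (cells n)

landmark-count : ∀ n → ∑ n (columnCount (landmark n)) ≤ n + 1 × (n % 3 ≢ 1 → ∑ n (columnCount (landmark n)) ≤ n)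
landmark-count 0 = z≤n , λ _ → z≤n
landmark-count 1 = ℕₚ.≤-refl , λ 1≢1 → ⊥-elim (1≢1 refl)
landmark-count 2 = ℕₚ.n≤1+n 2 , λ _ → ℕₚ.≤-refl
landmark-count (suc (suc (suc n))) =
  s≤s (s≤s (s≤s (proj₁ (landmark-count n)))) ,
  λ 3+n≢1 → s≤s (s≤s (s≤s (proj₂ (landmark-count n) (3+n≢1 ∘ trans [3+n]%3≡n%3))))
  where
    [3+n]%3≡n%3 : (3 + n) % 3 ≡ n % 3
    [3+n]%3≡n%3 = trans (cong (_% 3) (ℕₚ.+-comm 3 n)) ([m+n]%n≡m%n n 3)

landmarks-length : ∀ n → length (landmarks n) ≤ n + 1 × (n % 3 ≢ 1 → length (landmarks n) ≤ n)
landmarks-length n rewrite count-cells n (landmark n) = landmark-count n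

above : Position → List Position
above (zero  , c) = []
above (suc r , c) = (r , c) ∷ []

left : Position → List Position
left (r , zero)  = []
left (r , suc c) = (r , c) ∷ []

neighbours : Position → List Position
neighbours (r , c) = (suc r , c) ∷ (r , suc c) ∷ above (r , c) ++ left (r , c)

rows : List ℕ
rows = upTo 3

-- The tests use does rather than ⌊_⌋, which would block on the decision procedures and spoil the
-- definitional 3-periodicity exploited in localCheck-holds. The corner (1 , 0) is the only
-- non-landmark without a landmark neighbour.
dominated : ℕ → Position → Bool
dominated n p = landmark n p ∨ does (p ≟ₚ (1 , 0)) ∨ any (λ z → landmark n z ∧ does (adjacent? z p)) (neighbours p)

separated : ℕ → Position → Position → Bool
separated n p q =
  any (λ z → landmark n z ∧ (does (adjacent? z p) xor does (adjacent? z q))) (neighbours p ++ neighbours q)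

nearbyPairSeparated : ℕ → ℕ → ℕ × ℕ × ℕ → Bool
nearbyPairSeparated n c (r , r′ , d) =
  not (and ((c + d <ᵇ n) ∷ not (landmark n (r , c)) ∷ not (landmark n (r′ , c + d)) ∷ not ((d ≡ᵇ 0) ∧ (r ≡ᵇ r′)) ∷ []))
  ∨ separated n (r , c) (r′ , c + d)

localCheck : ℕ → ℕ → Bool
localCheck n c =
  all (λ r → dominated n (r , c)) rows ∧ all (nearbyPairSeparated n c) (cartesianProduct rows (cartesianProduct rows rows))

-- Away from the ends the pattern is 3-periodic, so localCheck (3 + n) (4 + c) and localCheck n (1 + c)
-- are the same boolean; the remaining cases are evaluated.
localCheck-holds : ∀ n c → c < n → T (localCheck n c)
localCheck-holds 1 0 _ = tt
localCheck-holds 2 0 _ = tt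
localCheck-holds 3 0 _ = tt
localCheck-holds 4 0 _ = tt
localCheck-holds (suc (suc (suc (suc (suc _))))) 0 _ = tt
localCheck-holds 2 1 _ = tt
localCheck-holds 3 1 _ = tt
localCheck-holds 4 1 _ = tt
localCheck-holds 5 1 _ = tt
localCheck-holds (suc (suc (suc (suc (suc (suc _)))))) 1 _ = tt
localCheck-holds 3 2 _ = tt
localCheck-holds 4 2 _ = tt
localCheck-holds 5 2 _ = tt
localCheck-holds 6 2 _ = tt
localCheck-holds (suc (suc (suc (suc (suc (suc (suc _))))))) 2 _ = tt
localCheck-holds 4 3 _ = tt
localCheck-holds 5 3 _ = tt
localCheck-holds 6 3 _ = tt
localCheck-holds 7 3 _ = tt
localCheck-holds (suc (suc (suc (suc (suc (suc (suc (suc _)))))))) 3 _ = tt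
localCheck-holds 1 (suc _) (s≤s ())
localCheck-holds 2 (suc (suc _)) (s≤s (s≤s ()))
localCheck-holds (suc (suc (suc n))) (suc (suc (suc (suc c)))) (s≤s (s≤s (s≤s c<n))) = localCheck-holds n (suc c) c<n

localCheck-dominated : ∀ n c → T (localCheck n c) → ∀ {r} → r < 3 → T (dominated n (r , c))
localCheck-dominated n c t r<3 =
  All.lookup (all⁺ (λ r → dominated n (r , c)) rows (proj₁ (Equivalence.to (T-∧ {all (λ r → dominated n (r , c)) rows}) t)))
             (∈-upTo⁺ r<3)

localCheck-nearby : ∀ n c → T (localCheck n c) → ∀ {r r′ d} → r < 3 → r′ < 3 → d < 3 →
                    T (nearbyPairSeparated n c (r , r′ , d))
localCheck-nearby n c t r<3 r′<3 d<3 =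
  All.lookup (all⁺ (nearbyPairSeparated n c) _ (proj₂ (Equivalence.to (T-∧ {all (λ r → dominated n (r , c)) rows}) t)))
             (∈-cartesianProduct⁺ (∈-upTo⁺ r<3) (∈-cartesianProduct⁺ (∈-upTo⁺ r′<3) (∈-upTo⁺ d<3)))

module UpperBound (n : ℕ) where

  Landmark : Position → Set
  Landmark p = T (landmark n p)

  landmark-inside : ∀ {r c} → Landmark (r , c) → r < 3 × c < n
  landmark-inside {r} {c} t =
    let c<ᵇn , sel = Equivalence.to T-∧ t in selected-row (columnKind n c) r sel , ℕₚ.<ᵇ⇒< c n c<ᵇn
    where
      selected-row : ∀ k r → T (selects k r) → r < 3
      selected-row pair   0 _ = z<s
      selected-row pair   2 _ = s<s (s<s z<s)
      selected-row middle 1 _ = s<s z<s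

  landmarks-∋ : ∀ {v} → Landmark (pos v) → v ∈ landmarks n
  landmarks-∋ = ∈-filter⁺ (T? ∘ landmark n ∘ pos) (cells-complete _)

  landmark-cell : ∀ {z} → Landmark z → Σ (Cell n) λ w → w ∈ landmarks n × pos w ≡ z
  landmark-cell {r , c} lm with landmark-inside lm
  ... | r<3 , c<n = cell r c r<3 c<n , landmarks-∋ (subst Landmark (sym (pos-cell r<3 c<n)) lm) , pos-cell r<3 c<n

  ∈-landmarks : ∀ {v} → v ∈ landmarks n → Landmark (pos v)
  ∈-landmarks = proj₂ ∘ ∈-filter⁻ (T? ∘ landmark n ∘ pos) {xs = cells n}

  Resolved : Cell n → Cell n → Set
  Resolved x y = Σ (Cell n) λ z → z ∈ landmarks n × Separates (Grid n) z x y

  resolved-sym : ∀ {x y} → Resolved y x → Resolved x y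
  resolved-sym (z , z∈ , sep) = z , z∈ , separates-sym (Grid n) sep

  landmark-separates : ∀ {x y z} → ¬ Landmark (pos y) → Landmark z → Adjacent z (pos x) → ¬ Adjacent z (pos y) →
                       Resolved x y
  landmark-separates {y = y} y∉ z-lm z~x z≁y with landmark-cell z-lm
  ... | w , w∈ , refl = w , w∈ , neighbour-separates (Grid n) w≢y (Adjacent⇒Adj z~x) (z≁y ∘ Adj⇒Adjacent)
    where
      w≢y : w ≢ y
      w≢y refl = y∉ (∈-landmarks w∈)

  separated-sound : ∀ {x y} → ¬ Landmark (pos x) → ¬ Landmark (pos y) → T (separated n (pos x) (pos y)) → Resolved x y
  separated-sound {x} {y} x∉ y∉ t
    with find (any⁻ (λ z → landmark n z ∧ (does (adjacent? z (pos x)) xor does (adjacent? z (pos y))))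
                    (neighbours (pos x) ++ neighbours (pos y)) t)
  ... | z , _ , zt with Equivalence.to T-∧ zt
  ... | z-lm , one-side with xor-cases (adjacent? z (pos x)) (adjacent? z (pos y)) one-side
  ... | inj₁ (z~x , z≁y) = landmark-separates y∉ z-lm z~x z≁y
  ... | inj₂ (z~y , z≁x) = resolved-sym (landmark-separates x∉ z-lm z~y z≁x)

  dominated-at : ∀ (x : Cell n) → ¬ Landmark (pos x) → pos x ≡ (1 , 0) ⊎ Σ Position λ z → Landmark z × Adjacent z (pos x)
  dominated-at x x∉
    with Equivalence.to (T-∨ {landmark n (pos x)})
                        (localCheck-dominated n _ (localCheck-holds n _ (proj₂ (pos-inside x))) (proj₁ (pos-inside x)))
  ... | inj₁ lm = ⊥-elim (x∉ lm)
  ... | inj₂ t with Equivalence.to (T-∨ {does (pos x ≟ₚ (1 , 0))}) t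
  ... | inj₁ corner = inj₁ (does⇒ {P? = pos x ≟ₚ (1 , 0)} corner)
  ... | inj₂ t′ = let z , _ , zt = find (any⁻ (λ z → landmark n z ∧ does (adjacent? z (pos x))) (neighbours (pos x)) t′)
                      z-lm , z~x = Equivalence.to T-∧ zt
                  in inj₂ (z , z-lm , does⇒ {P? = adjacent? z (pos x)} z~x)

  far-resolved : ∀ {x y} → ¬ Landmark (pos x) → ¬ Landmark (pos y) → proj₂ (pos x) + 3 ≤ proj₂ (pos y) → Resolved x y
  far-resolved {x} {y} x∉ y∉ gap with dominated-at x x∉
  ... | inj₂ (z , z-lm , z~x) = landmark-separates y∉ z-lm z~x (column-gap gap z~x)
  ... | inj₁ _ with dominated-at y y∉
  ... | inj₂ (z , z-lm , z~y) = resolved-sym (landmark-separates x∉ z-lm z~y (λ z~x → column-gap gap z~x z~y))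
  ... | inj₁ y-corner =
    case ℕₚ.≤-trans (ℕₚ.m≤n+m 3 (proj₂ (pos x))) (subst (proj₂ (pos x) + 3 ≤_) (cong proj₂ y-corner) gap) of λ ()

  near-resolved : ∀ {x y} d → x ≢ y → ¬ Landmark (pos x) → ¬ Landmark (pos y) →
                  proj₂ (pos x) + d ≡ proj₂ (pos y) → d < 3 → Resolved x y
  near-resolved {x@(i , j)} {y@(i′ , j′)} d x≢y x∉ y∉ eq d<3 =
    separated-sound x∉ y∉ (subst (λ c′ → T (separated n (pos x) (toℕ i′ , c′))) eq (implied pair-separated premise))
    where
      pair-separated : T (nearbyPairSeparated n (toℕ j) (toℕ i , toℕ i′ , d))
      pair-separated = localCheck-nearby n (toℕ j) (localCheck-holds n (toℕ j) (toℕ<n j)) (toℕ<n i) (toℕ<n i′) d<3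
      distinct : ¬ T ((d ≡ᵇ 0) ∧ (toℕ i ≡ᵇ toℕ i′))
      distinct t =
        let d≡ᵇ0 , i≡ᵇi′ = Equivalence.to (T-∧ {d ≡ᵇ 0}) t
        in x≢y (pos-injective (cong₂ _,_ (ℕₚ.≡ᵇ⇒≡ _ _ i≡ᵇi′)
                 (trans (sym (ℕₚ.+-identityʳ (toℕ j))) (trans (cong (toℕ j +_) (sym (ℕₚ.≡ᵇ⇒≡ d 0 d≡ᵇ0))) eq))))
      premise : T (and ((toℕ j + d <ᵇ n) ∷ not (landmark n (toℕ i , toℕ j)) ∷ not (landmark n (toℕ i′ , toℕ j + d)) ∷
                        not ((d ≡ᵇ 0) ∧ (toℕ i ≡ᵇ toℕ i′)) ∷ []))
      premise = and⁺ (ℕₚ.<⇒<ᵇ (subst (_< n) (sym eq) (toℕ<n j′)) ∷ not⁺ x∉ ∷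
                      not⁺ (y∉ ∘ subst (λ c′ → Landmark (toℕ i′ , c′)) eq) ∷ not⁺ distinct ∷ [])

  ordered-resolved : ∀ {x y} → x ≢ y → ¬ Landmark (pos x) → ¬ Landmark (pos y) → proj₂ (pos x) ≤ proj₂ (pos y) →
                     Resolved x y
  ordered-resolved {x} {y} x≢y x∉ y∉ cx≤cy with proj₂ (pos x) + 3 ℕₚ.≤? proj₂ (pos y)
  ... | yes gap = far-resolved x∉ y∉ gap
  ... | no ¬gap = near-resolved (proj₂ (pos y) ∸ proj₂ (pos x)) x≢y x∉ y∉ cx+d≡cy
                    (ℕₚ.+-cancelˡ-< (proj₂ (pos x)) _ 3 (subst (_< proj₂ (pos x) + 3) (sym cx+d≡cy) (ℕₚ.≰⇒> ¬gap)))
    where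
      cx+d≡cy : proj₂ (pos x) + (proj₂ (pos y) ∸ proj₂ (pos x)) ≡ proj₂ (pos y)
      cx+d≡cy = ℕₚ.m+[n∸m]≡n cx≤cy

  landmarks-resolve : AdjResolving (Grid n) (landmarks n)
  landmarks-resolve x y x≢y with T? (landmark n (pos x)) | T? (landmark n (pos y))
  ... | yes x-lm | _        = x , landmarks-∋ x-lm , self-separates (Grid n) x≢y
  ... | no _     | yes y-lm = resolved-sym (y , landmarks-∋ y-lm , self-separates (Grid n) (x≢y ∘ sym))
  ... | no x∉    | no y∉ with ℕₚ.≤-total (proj₂ (pos x)) (proj₂ (pos y))
  ... | inj₁ cx≤cy = ordered-resolved x≢y x∉ y∉ cx≤cy
  ... | inj₂ cy≤cx = resolved-sym (ordered-resolved (x≢y ∘ sym) y∉ x∉ cy≤cx)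

theorem1p12 : (n : ℕ) → 1 ≤ n →
    Σ ℕ (λ a → AdimIs (P 3 □ P n) a ×
      ((n % 3 ≡ 1 → n ≤ a × a ≤ n + 1) ×
       (¬ (n % 3 ≡ 1) → n ∸ 1 ≤ a × a ≤ n)))
theorem1p12 n _
  with adim-exists (Grid n) grid-adj? _≟ᶜ_ (cells n) cells-complete (cells-unique n)
                   (landmarks n) (UpperBound.landmarks-resolve n)
... | a , adim@((M , (_ , M-resolves) , refl) , _) , a≤landmarks =
  a , adim ,
  (λ _ → n≤a , ℕₚ.≤-trans a≤landmarks (proj₁ (landmarks-length n))) ,
  (λ n%3≢1 → ℕₚ.≤-trans (ℕₚ.m∸n≤m n 1) n≤a , ℕₚ.≤-trans a≤landmarks (proj₂ (landmarks-length n) n%3≢1))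
  where
    n≤a : n ≤ length M
    n≤a = LowerBound.lower-bound M M-resolves
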